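{- Let $d\ge 3$ be an integer, let $X$ be a finite set with $|X|=n$, and let $S\subseteq X^d$ be an orthogonal array of degree $d$ and strength $d-1$ on $X$. For each $r$-coloring of $X$ with color classes $X_1,\dots,X_r$ and densities $c_i=|X_i|/n$, and each $i\in\{1,\dots,r\}$, $$|S_i|+(-1)^{d-1}|M_i|=\big((1-c_i)^d-(-1)^d c_i^d\big)n^{d-1},$$ where $S_i$ is the set of vectors in $S$ having no coordinate in $X_i$ and $M_i$ is the set of vectors in $S$ with all coordinates in $X_i$. In particular, the total number $|M|$ of monochromatic vectors in $S$ satisfies $$\sum_{i=1}^r|S_i|+(-1)^{d-1}|M|=\sum_{i=1}^r\big((1-c_i)^d-(-1)^d c_i^d\big)n^{d-1}.$$
   Context: $S\subseteq X^d$ is an orthogonal array of degree $d$ and strength $k$ on $X$ if for every choice of indices $1\le i_1<\dots<i_k\le d$ and every $(a_1,\dots,a_k)\in X^k$ there is exactly one $(y_1,\dots,y_d)\in S$ with $y_{i_j}=a_j$ for all $j$. A vector is monochromatic if all its coordinates lie in the same color class. -}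

module Defs where

open import Data.Nat as ℕ using (ℕ; zero; suc; _<_; _≤_)
open import Data.Integer using (+_)
open import Data.Fin as Fin using (Fin)
import Data.Fin.Properties as FinP
open import Data.Vec using (Vec; lookup)
open import Data.List using (List; length; filter; map; allFin; foldr)
open import Data.Rational using (ℚ; 0ℚ; 1ℚ; _+_; _*_; _-_; -_; _/_)
open import Relation.Binary.PropositionalEquality using (_≡_)
open import Relation.Nullary using (¬_; Dec)
open import Relation.Nullary.Decidable using (¬?)
open import Data.Product using (∃)

count : ∀ {a p} {A : Set a} {P : A → Set p} → (∀ x → Dec (P x)) → List A → ℕ
count P? xs = length (filter P? xs)

agreesOn : ∀ {n d k} → (Fin k → Fin d) → (Fin k → Fin n) → Vec (Fin n) d → Set
agreesOn ι a y = ∀ j → lookup y (ι j) ≡ a j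

agreesOn? : ∀ {n d k} (ι : Fin k → Fin d) (a : Fin k → Fin n) (y : Vec (Fin n) d) →
            Dec (agreesOn ι a y)
agreesOn? ι a y = FinP.all? (λ j → lookup y (ι j) Fin.≟ a j)

-- S (a duplicate-free list of vectors in X^d, X = Fin n) is an orthogonal array
-- of degree d and strength k on X: for every strictly increasing choice of k
-- indices and every a ∈ X^k there is exactly one y ∈ S with y_{ι j} = a_j.
IsOrthogonalArray : (n d k : ℕ) → List (Vec (Fin n) d) → Set
IsOrthogonalArray n d k S =
  (ι : Fin k → Fin d) → (∀ {a b} → a Fin.< b → ι a Fin.< ι b) →
  (a : Fin k → Fin n) → count (agreesOn? ι a) S ≡ 1

HasNoCoordIn : ∀ {n d r} → (Fin n → Fin r) → Fin r → Vec (Fin n) d → Set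
HasNoCoordIn χ i y = ∀ j → ¬ (χ (lookup y j) ≡ i)

hasNoCoordIn? : ∀ {n d r} (χ : Fin n → Fin r) (i : Fin r) (y : Vec (Fin n) d) →
                Dec (HasNoCoordIn χ i y)
hasNoCoordIn? χ i y = FinP.all? (λ j → ¬? (χ (lookup y j) Fin.≟ i))

AllCoordsIn : ∀ {n d r} → (Fin n → Fin r) → Fin r → Vec (Fin n) d → Set
AllCoordsIn χ i y = ∀ j → χ (lookup y j) ≡ i

allCoordsIn? : ∀ {n d r} (χ : Fin n → Fin r) (i : Fin r) (y : Vec (Fin n) d) →
               Dec (AllCoordsIn χ i y)
allCoordsIn? χ i y = FinP.all? (λ j → χ (lookup y j) Fin.≟ i)

Monochromatic : ∀ {n d r} → (Fin n → Fin r) → Vec (Fin n) d → Set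
Monochromatic χ y = ∃ λ i → AllCoordsIn χ i y

monochromatic? : ∀ {n d r} (χ : Fin n → Fin r) (y : Vec (Fin n) d) →
                 Dec (Monochromatic χ y)
monochromatic? χ y = FinP.any? (λ i → allCoordsIn? χ i y)

classSize : ∀ {n r} → (Fin n → Fin r) → Fin r → ℕ
classSize {n} χ i = count (λ x → χ x Fin.≟ i) (allFin n)

infixr 8 _^ℚ_
_^ℚ_ : ℚ → ℕ → ℚ
q ^ℚ zero = 1ℚ
q ^ℚ suc m = q * (q ^ℚ m)

ℚsum : ∀ {r} → (Fin r → ℚ) → ℚ
ℚsum {r} f = foldr _+_ 0ℚ (map f (allFin r))

ℕtoℚ : ℕ → ℚ
ℕtoℚ m = + m / 1

module Submission where

-- Fix a colour i, let a(x) ∈ {0,1} indicate x ∈ X_i and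
-- write d = m + 1.  For a vector y ∈ X^d,
--   [y has no coordinate in X_i] - (-1)^d [y ∈ X_i^d]
--     = ∏_j (1 - a(y_j)) - ∏_j (-a(y_j)),
-- and telescoping this difference of products writes it as a sum of d
-- terms, the k-th of which is a product over the m coordinates j ≠ k of
-- factors -a(y_j) (for j < k) or 1 - a(y_j) (for j > k).  Summing a product
-- of m one-variable functions over an orthogonal array of strength m gives
-- the product of their sums over X, so ∑_{y ∈ S} of the k-th term is
-- (-|X_i|)^k (n - |X_i|)^(m-k).  The same telescoping applied to the
-- constant vector (c_i, …, c_i) and scaled by n^m yields the same value,
-- which is the identity for one colour.  Summing over the colours, and
-- noting that a vector is monochromatic for at most one colour, gives the
-- identity for all monochromatic vectors.

open import Defs
open import Data.Nat as ℕ using (ℕ; zero; suc; NonZero; _≥_; _∸_)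
import Data.Nat.Properties as ℕP
import Data.Integer as ℤ
open import Data.Fin as Fin using (Fin; zero; suc; punchIn)
import Data.Fin.Properties as FinP
open import Data.Vec using (Vec; lookup)
open import Data.Vec.Functional using () renaming ([] to []ᶠ; _∷_ to _∷ᶠ_)
open import Data.List as List using (List; []; _∷_; length; map; allFin; foldr; tabulate)
open import Data.List.Relation.Unary.Unique.Propositional using (Unique)
open import Data.Bool using (if_then_else_; true; false)
open import Data.Rational using (ℚ; 0ℚ; 1ℚ; _+_; _*_; _-_; -_; _/_; toℚᵘ)
open import Data.Rational.Properties
  using ( toℚᵘ-injective; toℚᵘ-fromℚᵘ; toℚᵘ-homo-+; toℚᵘ-homo-*
        ; +-*-commutativeRing; *-1-commutativeMonoid
        ; +-identityˡ; +-identityʳ; +-inverseʳ; *-identityˡ; *-zeroˡ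
        ; neg-distrib-+; neg-distribˡ-* )
open import Data.Rational.Unnormalised as ℚᵘ using (mkℚᵘ; *≡*) renaming (_≃_ to _≃ᵘ_)
import Data.Rational.Unnormalised.Properties as ℚᵘP
open import Algebra.Bundles using (CommutativeRing)
open import Algebra.Properties.Semiring.Sum (CommutativeRing.semiring +-*-commutativeRing)
  using (sum; sum-syntax; sum-cong-≗; ∑-distrib-+; ∑-comm; *-distribˡ-sum; *-distribʳ-sum; sum-replicate-zero)
open import Algebra.Properties.CommutativeMonoid.Sum *-1-commutativeMonoid
  using () renaming (sum to prod; sum-cong-≗ to prod-cong-≗; ∑-distrib-+ to prod-distrib-*)
open import Data.Product using (_×_; _,_; ∃)
open import Relation.Nullary using (Dec; does; yes; no; ¬_; contradiction)
open import Relation.Nullary.Decidable using (¬?)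
open import Relation.Binary.PropositionalEquality
open import Function using (_∘_)

-- A fraction z / n is represented unnormalised by the same numerator and
-- denominator; this reduces statements about ℕtoℚ to integer arithmetic.
toℚᵘ-/ : ∀ z n .{{_ : NonZero n}} → toℚᵘ (z / n) ≃ᵘ mkℚᵘ z (ℕ.pred n)
toℚᵘ-/ z (suc k) = toℚᵘ-fromℚᵘ (mkℚᵘ z k)

ℕtoℚ-suc : ∀ k → ℕtoℚ (suc k) ≡ 1ℚ + ℕtoℚ k
ℕtoℚ-suc k = toℚᵘ-injective (begin
  toℚᵘ (ℕtoℚ (suc k))
    ≈⟨ toℚᵘ-/ (ℤ.+ suc k) 1 ⟩
  mkℚᵘ (ℤ.+ suc k) 0
    ≈⟨ *≡* (solve 1 (λ x → (con (ℤ.+ 1) :+ x) :* con (ℤ.+ 1)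
                       := (con (ℤ.+ 1) :* con (ℤ.+ 1) :+ x :* con (ℤ.+ 1)) :* con (ℤ.+ 1))
                  refl (ℤ.+ k)) ⟩
  mkℚᵘ (ℤ.+ 1) 0 ℚᵘ.+ mkℚᵘ (ℤ.+ k) 0
    ≈⟨ ℚᵘP.+-cong (ℚᵘP.≃-sym (toℚᵘ-/ (ℤ.+ 1) 1)) (ℚᵘP.≃-sym (toℚᵘ-/ (ℤ.+ k) 1)) ⟩
  toℚᵘ 1ℚ ℚᵘ.+ toℚᵘ (ℕtoℚ k)
    ≈⟨ ℚᵘP.≃-sym (toℚᵘ-homo-+ 1ℚ (ℕtoℚ k)) ⟩
  toℚᵘ (1ℚ + ℕtoℚ k)
    ∎)
  where
  open ℚᵘP.≃-Reasoning
  open import Data.Integer.Solver using (module +-*-Solver)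
  open +-*-Solver

fraction-times-denominator : ∀ A n .{{_ : NonZero n}} → (ℤ.+ A / n) * ℕtoℚ n ≡ ℕtoℚ A
fraction-times-denominator A n@(suc k) = toℚᵘ-injective (begin
  toℚᵘ ((ℤ.+ A / n) * ℕtoℚ n)
    ≈⟨ toℚᵘ-homo-* (ℤ.+ A / n) (ℕtoℚ n) ⟩
  toℚᵘ (ℤ.+ A / n) ℚᵘ.* toℚᵘ (ℕtoℚ n)
    ≈⟨ ℚᵘP.*-cong (toℚᵘ-/ (ℤ.+ A) n) (toℚᵘ-/ (ℤ.+ n) 1) ⟩
  mkℚᵘ (ℤ.+ A) k ℚᵘ.* mkℚᵘ (ℤ.+ n) 0
    ≈⟨ *≡* (solve 2 (λ a b → (a :* b) :* con (ℤ.+ 1) := a :* (b :* con (ℤ.+ 1))) refl (ℤ.+ A) (ℤ.+ n)) ⟩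
  mkℚᵘ (ℤ.+ A) 0
    ≈⟨ ℚᵘP.≃-sym (toℚᵘ-/ (ℤ.+ A) 1) ⟩
  toℚᵘ (ℕtoℚ A)
    ∎)
  where
  open ℚᵘP.≃-Reasoning
  open import Data.Integer.Solver using (module +-*-Solver)
  open +-*-Solver

-- Ring normalisation in ℚ for the routine algebraic steps below (opened
-- only here because the integer solver above uses the same names).
open import Data.Rational.Solver using (module +-*-Solver)
open +-*-Solver

sum-neg : ∀ {m} (f : Fin m → ℚ) → ∑[ k < m ] (- f k) ≡ - sum f
sum-neg {zero}  f = refl
sum-neg {suc m} f = begin
  - f zero + ∑[ k < m ] (- f (suc k))  ≡⟨ cong (- f zero +_) (sum-neg (f ∘ suc)) ⟩
  - f zero + - sum (f ∘ suc)           ≡⟨ sym (neg-distrib-+ (f zero) (sum (f ∘ suc))) ⟩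
  - (f zero + sum (f ∘ suc))           ∎
  where open ≡-Reasoning

sum-sub : ∀ {m} (f g : Fin m → ℚ) → ∑[ k < m ] (f k - g k) ≡ sum f - sum g
sum-sub f g = trans (∑-distrib-+ f (λ k → - g k)) (cong (sum f +_) (sum-neg g))

sum-sub-* : ∀ {m} s (f g : Fin m → ℚ) → ∑[ k < m ] (f k - s * g k) ≡ sum f - s * sum g
sum-sub-* s f g = trans (sum-sub f (λ k → s * g k)) (cong (λ t → sum f - t) (sym (*-distribˡ-sum s g)))

sum-ones : ∀ n → ∑[ x < n ] 1ℚ ≡ ℕtoℚ n
sum-ones zero    = refl
sum-ones (suc n) = trans (cong (1ℚ +_) (sum-ones n)) (sym (ℕtoℚ-suc n))

prod-const : ∀ m q → prod {m} (λ _ → q) ≡ q ^ℚ m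
prod-const zero    q = refl
prod-const (suc m) q = cong (q *_) (prod-const m q)

prod-neg : ∀ {m} (f : Fin m → ℚ) → prod (λ j → - f j) ≡ (- 1ℚ) ^ℚ m * prod f
prod-neg {zero}  f = sym (*-identityˡ 1ℚ)
prod-neg {suc m} f = begin
  - f zero * prod (λ j → - f (suc j))      ≡⟨ cong ((- f zero) *_) (prod-neg (f ∘ suc)) ⟩
  - f zero * ((- 1ℚ) ^ℚ m * prod (f ∘ suc)) ≡⟨ solve 3 (λ a s p → (:- a) :* (s :* p) := ((:- con 1ℚ) :* s) :* (a :* p))
                                                      refl (f zero) ((- 1ℚ) ^ℚ m) (prod (f ∘ suc)) ⟩
  (- 1ℚ) ^ℚ suc m * prod f                 ∎
  where open ≡-Reasoning

∑ℓ : ∀ {A : Set} → List A → (A → ℚ) → ℚ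
∑ℓ xs f = ∑[ k < length xs ] f (List.lookup xs k)

∑ℓ-tabulate : ∀ {A : Set} r (g : Fin r → A) (f : A → ℚ) → ∑ℓ (tabulate g) f ≡ ∑[ k < r ] f (g k)
∑ℓ-tabulate zero    g f = refl
∑ℓ-tabulate (suc r) g f = cong (f (g zero) +_) (∑ℓ-tabulate r (g ∘ suc) f)

ℚsum≡sum : ∀ {r} (f : Fin r → ℚ) → ℚsum f ≡ sum f
ℚsum≡sum {r} f = trans (foldr-map (allFin r)) (∑ℓ-tabulate r (λ k → k) f)
  where
  foldr-map : ∀ xs → foldr _+_ 0ℚ (map f xs) ≡ ∑ℓ xs f
  foldr-map []       = refl
  foldr-map (x ∷ xs) = cong (f x +_) (foldr-map xs)

ind : ∀ {p} {P : Set p} → Dec P → ℚ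
ind D = if does D then 1ℚ else 0ℚ

ind-yes : ∀ {P : Set} → P → (D : Dec P) → ind D ≡ 1ℚ
ind-yes p (yes _) = refl
ind-yes p (no ¬p) = contradiction p ¬p

ind-no : ∀ {P : Set} → ¬ P → (D : Dec P) → ind D ≡ 0ℚ
ind-no ¬p (yes p) = contradiction p ¬p
ind-no ¬p (no _)  = refl

ind-cong : ∀ {P Q : Set} → (P → Q) → (Q → P) → (D : Dec P) (E : Dec Q) → ind D ≡ ind E
ind-cong P→Q Q→P (yes p) E = sym (ind-yes (P→Q p) E)
ind-cong P→Q Q→P (no ¬p) E = sym (ind-no (¬p ∘ Q→P) E)

ind-¬ : ∀ {P : Set} (D : Dec P) → ind (¬? D) ≡ 1ℚ - ind D
ind-¬ (yes _) = sym (+-inverseʳ 1ℚ)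
ind-¬ (no _)  = refl

count-as-sum : ∀ {A : Set} {P : A → Set} (P? : ∀ x → Dec (P x)) xs →
               ℕtoℚ (count P? xs) ≡ ∑ℓ xs (λ x → ind (P? x))
count-as-sum P? []       = refl
count-as-sum P? (x ∷ xs) with does (P? x)
... | true  = trans (ℕtoℚ-suc (count P? xs)) (cong (1ℚ +_) (count-as-sum P? xs))
... | false = trans (count-as-sum P? xs) (sym (+-identityˡ _))

ind-all : ∀ {m} {P : Fin m → Set} (P? : ∀ j → Dec (P j)) (D : Dec (∀ j → P j)) →
          ind D ≡ prod (λ j → ind (P? j))
ind-all {zero}  P? D = ind-yes (λ ()) D
ind-all {suc m} {P} P? D with P? zero
... | yes p₀ = begin
  ind D                            ≡⟨ ind-cong (λ h j → h (suc j)) (λ { h zero → p₀ ; h (suc j) → h j })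
                                               D rest? ⟩
  ind rest?                        ≡⟨ ind-all (P? ∘ suc) rest? ⟩
  prod (λ j → ind (P? (suc j)))    ≡⟨ sym (*-identityˡ _) ⟩
  1ℚ * prod (λ j → ind (P? (suc j))) ∎
  where
  open ≡-Reasoning
  rest? : Dec (∀ j → P (suc j))
  rest? = FinP.all? (P? ∘ suc)
... | no ¬p₀ = trans (ind-no (λ h → ¬p₀ (h zero)) D) (sym (*-zeroˡ (prod (λ j → ind (P? (suc j))))))

ind-any : ∀ {r} {P : Fin r → Set} (P? : ∀ i → Dec (P i)) →
          (∀ {i i′} → P i → P i′ → i ≡ i′) → (D : Dec (∃ P)) →
          ind D ≡ ∑[ i < r ] ind (P? i)
ind-any {zero}  P? exclusive D = ind-no (λ { (() , _) }) D
ind-any {suc r} {P} P? exclusive D with P? zero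
... | yes p₀ = begin
  ind D                             ≡⟨ ind-yes (zero , p₀) D ⟩
  1ℚ                                ≡⟨ sym (+-identityʳ 1ℚ) ⟩
  1ℚ + 0ℚ                           ≡⟨ cong (1ℚ +_) (sym (sum-replicate-zero r)) ⟩
  1ℚ + ∑[ i < r ] 0ℚ                ≡⟨ cong (1ℚ +_) (sum-cong-≗ (λ i → sym (others i))) ⟩
  1ℚ + ∑[ i < r ] ind (P? (suc i))  ∎
  where
  open ≡-Reasoning
  others : ∀ i → ind (P? (suc i)) ≡ 0ℚ
  others i = ind-no (λ p → FinP.0≢1+n (exclusive p₀ p)) (P? (suc i))
... | no ¬p₀ = begin
  ind D                             ≡⟨ ind-cong (λ { (zero , p) → contradiction p ¬p₀ ; (suc i , p) → i , p })
                                                (λ { (i , p) → suc i , p }) D rest? ⟩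
  ind rest?                         ≡⟨ ind-any (P? ∘ suc) (λ p p′ → FinP.suc-injective (exclusive p p′)) rest? ⟩
  ∑[ i < r ] ind (P? (suc i))       ≡⟨ sym (+-identityˡ _) ⟩
  0ℚ + ∑[ i < r ] ind (P? (suc i))  ∎
  where
  open ≡-Reasoning
  rest? : Dec (∃ λ i → P (suc i))
  rest? = FinP.any? (P? ∘ suc)

ind-≟-sum : ∀ {n} (w : Fin n) (h : Fin n → ℚ) → ∑[ x < n ] (ind (w Fin.≟ x) * h x) ≡ h w
ind-≟-sum {suc n} zero h = begin
  1ℚ * h zero + ∑[ x < n ] (0ℚ * h (suc x))
    ≡⟨ cong₂ _+_ (*-identityˡ (h zero)) (sum-cong-≗ (λ x → *-zeroˡ (h (suc x)))) ⟩
  h zero + ∑[ x < n ] 0ℚ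
    ≡⟨ cong (h zero +_) (sum-replicate-zero n) ⟩
  h zero + 0ℚ
    ≡⟨ +-identityʳ (h zero) ⟩
  h zero
    ∎
  where open ≡-Reasoning
ind-≟-sum {suc n} (suc w) h = begin
  0ℚ * h zero + rest ≡⟨ cong (_+ rest) (*-zeroˡ (h zero)) ⟩
  0ℚ + rest          ≡⟨ +-identityˡ rest ⟩
  rest               ≡⟨ ind-≟-sum w (h ∘ suc) ⟩
  h (suc w)          ∎
  where
  open ≡-Reasoning
  rest : ℚ
  rest = ∑[ x < n ] (ind (w Fin.≟ x) * h (suc x))

∑ᵗ : ∀ {n} m → ((Fin m → Fin n) → ℚ) → ℚ
∑ᵗ     zero    g = g []ᶠ
∑ᵗ {n} (suc m) g = ∑[ x < n ] ∑ᵗ m (λ a → g (x ∷ᶠ a))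

∑ᵗ-cong : ∀ {n} m {f g : (Fin m → Fin n) → ℚ} → (∀ a → f a ≡ g a) → ∑ᵗ m f ≡ ∑ᵗ m g
∑ᵗ-cong zero    f≗g = f≗g []ᶠ
∑ᵗ-cong (suc m) f≗g = sum-cong-≗ (λ x → ∑ᵗ-cong m (λ a → f≗g (x ∷ᶠ a)))

∑ᵗ-*ˡ : ∀ {n} m c (g : (Fin m → Fin n) → ℚ) → c * ∑ᵗ m g ≡ ∑ᵗ m (λ a → c * g a)
∑ᵗ-*ˡ zero    c g = refl
∑ᵗ-*ˡ (suc m) c g =
  trans (*-distribˡ-sum c (λ x → ∑ᵗ m (λ a → g (x ∷ᶠ a))))
        (sum-cong-≗ (λ x → ∑ᵗ-*ˡ m c (λ a → g (x ∷ᶠ a))))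

sum-∑ᵗ-comm : ∀ {n K} m (F : Fin K → (Fin m → Fin n) → ℚ) →
              ∑[ k < K ] ∑ᵗ m (F k) ≡ ∑ᵗ m (λ a → ∑[ k < K ] F k a)
sum-∑ᵗ-comm zero    F = refl
sum-∑ᵗ-comm (suc m) F =
  trans (∑-comm (λ k x → ∑ᵗ m (λ a → F k (x ∷ᶠ a))))
        (sum-cong-≗ (λ x → sum-∑ᵗ-comm m (λ k a → F k (x ∷ᶠ a))))

∑ᵗ-prod : ∀ {n} m (H : Fin m → Fin n → ℚ) →
          ∑ᵗ m (λ a → prod (λ j → H j (a j))) ≡ prod (λ j → ∑[ x < n ] H j x)
∑ᵗ-prod     zero    H = refl
∑ᵗ-prod {n} (suc m) H = begin
  ∑[ x < n ] ∑ᵗ m (λ a → H zero x * Rest a)   ≡⟨ sum-cong-≗ (λ x → sym (∑ᵗ-*ˡ m (H zero x) Rest)) ⟩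
  ∑[ x < n ] (H zero x * ∑ᵗ m Rest)           ≡⟨ sum-cong-≗ (λ x → cong (H zero x *_) (∑ᵗ-prod m (H ∘ suc))) ⟩
  ∑[ x < n ] (H zero x * ∏rest)               ≡⟨ sym (*-distribʳ-sum ∏rest (H zero)) ⟩
  sum (H zero) * ∏rest                        ∎
  where
  open ≡-Reasoning
  Rest : (Fin m → Fin n) → ℚ
  Rest a = prod (λ j → H (suc j) (a j))
  ∏rest : ℚ
  ∏rest = prod (λ j → sum (H (suc j)))

prod-at : ∀ {n} m (w : Fin m → Fin n) (H : Fin m → Fin n → ℚ) →
          prod (λ j → H j (w j))
          ≡ ∑ᵗ m (λ a → ind (FinP.all? (λ j → w j Fin.≟ a j)) * prod (λ j → H j (a j)))
prod-at {n} m w H = begin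
  prod (λ j → H j (w j))
    ≡⟨ prod-cong-≗ (λ j → sym (ind-≟-sum (w j) (H j))) ⟩
  prod (λ j → ∑[ x < n ] (ind (w j Fin.≟ x) * H j x))
    ≡⟨ sym (∑ᵗ-prod m (λ j x → ind (w j Fin.≟ x) * H j x)) ⟩
  ∑ᵗ m (λ a → prod (λ j → ind (w j Fin.≟ a j) * H j (a j)))
    ≡⟨ ∑ᵗ-cong m (λ a → prod-distrib-* (λ j → ind (w j Fin.≟ a j)) (λ j → H j (a j))) ⟩
  ∑ᵗ m (λ a → prod (λ j → ind (w j Fin.≟ a j)) * prod (λ j → H j (a j)))
    ≡⟨ ∑ᵗ-cong m (λ a → cong (_* prod (λ j → H j (a j)))
                              (sym (ind-all (λ j → w j Fin.≟ a j) (FinP.all? (λ j → w j Fin.≟ a j))))) ⟩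
  ∑ᵗ m (λ a → ind (FinP.all? (λ j → w j Fin.≟ a j)) * prod (λ j → H j (a j)))
    ∎
  where open ≡-Reasoning

-- If every a ∈ X^m is matched by
-- exactly one y ∈ S on the coordinates ι, then summing over S a product of
-- one-variable functions of those coordinates is the same as summing it
-- over X^m.
orthogonal-array-sum : ∀ {n d m} (S : List (Vec (Fin n) d)) (ι : Fin m → Fin d) →
  (∀ a → count (agreesOn? ι a) S ≡ 1) → (H : Fin m → Fin n → ℚ) →
  ∑ℓ S (λ y → prod (λ j → H j (lookup y (ι j)))) ≡ prod (λ j → ∑[ x < n ] H j x)
orthogonal-array-sum {n} {m = m} S ι exactlyOne H = begin
  ∑ℓ S (λ y → G (λ j → lookup y (ι j)))
    ≡⟨ sum-cong-≗ (λ k → prod-at m (λ j → lookup (List.lookup S k) (ι j)) H) ⟩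
  ∑ℓ S (λ y → ∑ᵗ m (λ a → ind (agreesOn? ι a y) * G a))
    ≡⟨ sum-∑ᵗ-comm m (λ k a → ind (agreesOn? ι a (List.lookup S k)) * G a) ⟩
  ∑ᵗ m (λ a → ∑ℓ S (λ y → ind (agreesOn? ι a y) * G a))
    ≡⟨ ∑ᵗ-cong m (λ a → sym (*-distribʳ-sum (G a) (λ k → ind (agreesOn? ι a (List.lookup S k))))) ⟩
  ∑ᵗ m (λ a → ∑ℓ S (λ y → ind (agreesOn? ι a y)) * G a)
    ≡⟨ ∑ᵗ-cong m (λ a → cong (_* G a) (trans (sym (count-as-sum (agreesOn? ι a) S))
                                              (cong ℕtoℚ (exactlyOne a)))) ⟩
  ∑ᵗ m (λ a → 1ℚ * G a)
    ≡⟨ ∑ᵗ-cong m (λ a → *-identityˡ (G a)) ⟩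
  ∑ᵗ m G
    ≡⟨ ∑ᵗ-prod m H ⟩
  prod (λ j → ∑[ x < n ] H j x)
    ∎
  where
  open ≡-Reasoning
  G : (Fin m → Fin n) → ℚ
  G a = prod (λ j → H j (a j))

-- Telescoping.  The coordinates other than k ∈ Fin (1+m) are enumerated by
-- punchIn k : Fin m → Fin (1+m); `pick k j p q` is p if the j-th of them
-- precedes k and q if it follows k.

pick : ∀ {m} {A : Set} → Fin (suc m) → Fin m → A → A → A
pick zero    j       p q = q
pick (suc k) zero    p q = p
pick (suc k) (suc j) p q = pick k j p q

pick-map : ∀ {m} {A B : Set} (F : A → B) (k : Fin (suc m)) (j : Fin m) (p q : A) →
           F (pick k j p q) ≡ pick k j (F p) (F q)
pick-map F zero    j       p q = refl
pick-map F (suc k) zero    p q = refl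
pick-map F (suc k) (suc j) p q = pick-map F k j p q

telescopingTerm : ∀ {m} → Fin (suc m) → (Fin (suc m) → ℚ) → (Fin (suc m) → ℚ) → ℚ
telescopingTerm k u v = prod (λ j → pick k j (u (punchIn k j)) (v (punchIn k j)))

telescope : ∀ m (u v : Fin (suc m) → ℚ) →
            prod v - prod u ≡ ∑[ k < suc m ] ((v k - u k) * telescopingTerm k u v)
telescope zero u v =
  solve 2 (λ u₀ v₀ → v₀ :* con 1ℚ :- u₀ :* con 1ℚ := (v₀ :- u₀) :* con 1ℚ :+ con 0ℚ)
          refl (u zero) (v zero)
telescope (suc m) u v = begin
  v₀ * V - u₀ * U
    ≡⟨ solve 4 (λ v₀ u₀ V U → v₀ :* V :- u₀ :* U := (v₀ :- u₀) :* V :+ u₀ :* (V :- U)) refl v₀ u₀ V U ⟩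
  (v₀ - u₀) * V + u₀ * (V - U)
    ≡⟨ cong (λ t → (v₀ - u₀) * V + u₀ * t) (telescope m (u ∘ suc) (v ∘ suc)) ⟩
  (v₀ - u₀) * V + u₀ * ∑[ k < suc m ] T k
    ≡⟨ cong ((v₀ - u₀) * V +_) (*-distribˡ-sum u₀ T) ⟩
  (v₀ - u₀) * V + ∑[ k < suc m ] (u₀ * T k)
    ≡⟨ cong ((v₀ - u₀) * V +_) (sum-cong-≗ shift) ⟩
  ∑[ k < suc (suc m) ] ((v k - u k) * telescopingTerm k u v)
    ∎
  where
  open ≡-Reasoning
  u₀ v₀ U V : ℚ
  u₀ = u zero
  v₀ = v zero
  U  = prod (u ∘ suc)
  V  = prod (v ∘ suc)
  T : Fin (suc m) → ℚ
  T k = (v (suc k) - u (suc k)) * telescopingTerm k (u ∘ suc) (v ∘ suc)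
  -- moving u₀ inside: the term of index suc k starts with the factor u₀
  shift : ∀ k → u₀ * T k ≡ (v (suc k) - u (suc k)) * (u₀ * telescopingTerm k (u ∘ suc) (v ∘ suc))
  shift k = solve 3 (λ a b c → a :* (b :* c) := b :* (a :* c)) refl u₀ (v (suc k) - u (suc k))
                    (telescopingTerm k (u ∘ suc) (v ∘ suc))

-- Specialisation to v = 1 - a, u = -a, where every v_k - u_k = 1: for
-- weights a : X → ℚ and y ∈ X^(1+m),
--   ∏ (1 - a(y_j)) - ∏ (-a(y_j)) = ∑_k ∏_{j ≠ k} w_{k,j}(y_j),
-- with w_{k,j} = -a before k and 1 - a after k.
weight : ∀ {m} {X : Set} → Fin (suc m) → Fin m → (X → ℚ) → X → ℚ
weight k j a x = pick k j (- a x) (1ℚ - a x)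

complement-difference : ∀ m {X : Set} (a : X → ℚ) (y : Fin (suc m) → X) →
  prod (λ j → 1ℚ - a (y j)) - prod (λ j → - a (y j))
  ≡ ∑[ k < suc m ] prod (λ j → weight k j a (y (punchIn k j)))
complement-difference m a y =
  trans (telescope m (λ j → - a (y j)) (λ j → 1ℚ - a (y j)))
        (sum-cong-≗ (λ k → trans (cong (_* term k) (unit-gap (a (y k)))) (*-identityˡ (term k))))
  where
  term : Fin (suc m) → ℚ
  term k = prod (λ j → weight k j a (y (punchIn k j)))
  unit-gap : ∀ t → (1ℚ - t) - (- t) ≡ 1ℚ
  unit-gap = solve 1 (λ t → (con 1ℚ :- t) :- (:- t) := con 1ℚ) refl

-- The monomial p^k q^(m-k), as a product over the m indices other than k,
-- and h_m(p, q) = ∑_{k ≤ m} p^k q^(m-k), the value of the telescoping sum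
-- on the constant vectors u = p, v = q.
monomial : ∀ m → Fin (suc m) → ℚ → ℚ → ℚ
monomial m k p q = prod (λ j → pick {m} k j p q)

mixedSum : ∀ m → ℚ → ℚ → ℚ
mixedSum m p q = ∑[ k < suc m ] monomial m k p q

mixedSum-homogeneous : ∀ m p q t → mixedSum m p q * t ^ℚ m ≡ mixedSum m (p * t) (q * t)
mixedSum-homogeneous m p q t =
  trans (*-distribʳ-sum (t ^ℚ m) (λ k → monomial m k p q)) (sum-cong-≗ scale)
  where
  open ≡-Reasoning
  scale : ∀ k → monomial m k p q * t ^ℚ m ≡ monomial m k (p * t) (q * t)
  scale k = begin
    monomial m k p q * t ^ℚ m                  ≡⟨ cong (monomial m k p q *_) (sym (prod-const m t)) ⟩
    monomial m k p q * prod {m} (λ _ → t)      ≡⟨ sym (prod-distrib-* (λ j → pick k j p q) (λ _ → t)) ⟩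
    prod (λ (j : Fin m) → pick k j p q * t)    ≡⟨ prod-cong-≗ (λ j → pick-map (_* t) k j p q) ⟩
    monomial m k (p * t) (q * t)               ∎

punchIn-mono-< : ∀ {m} (k : Fin (suc m)) {j j′ : Fin m} → j Fin.< j′ → punchIn k j Fin.< punchIn k j′
punchIn-mono-< k {j} {j′} j<j′ =
  FinP.≤∧≢⇒< (FinP.punchIn-mono-≤ k j j′ (ℕP.<⇒≤ j<j′))
             (FinP.<⇒≢ j<j′ ∘ FinP.punchIn-injective k j j′)

module ColourClass {n r : ℕ} .{{_ : NonZero n}} (χ : Fin n → Fin r) (i : Fin r) where

  a : Fin n → ℚ
  a x = ind (χ x Fin.≟ i)

  A N c : ℚ
  A = ℕtoℚ (classSize χ i)
  N = ℕtoℚ n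
  c = ℤ.+ classSize χ i / n

  sum-a : ∑[ x < n ] a x ≡ A
  sum-a = sym (trans (count-as-sum (λ x → χ x Fin.≟ i) (allFin n)) (∑ℓ-tabulate n (λ x → x) a))

  weight-sum : ∀ {m} (k : Fin (suc m)) (j : Fin m) → ∑[ x < n ] weight k j a x ≡ pick k j (- A) (N - A)
  weight-sum k j = begin
    ∑[ x < n ] weight k j a x
      ≡⟨ sum-cong-≗ (λ x → sym (pick-map (λ h → h x) k j (λ x → - a x) (λ x → 1ℚ - a x))) ⟩
    sum (pick k j (λ x → - a x) (λ x → 1ℚ - a x))
      ≡⟨ pick-map sum k j (λ x → - a x) (λ x → 1ℚ - a x) ⟩
    pick k j (∑[ x < n ] (- a x)) (∑[ x < n ] (1ℚ - a x))
      ≡⟨ cong₂ (pick k j) (trans (sum-neg a) (cong -_ sum-a))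
                          (trans (sum-sub (λ _ → 1ℚ) a) (cong₂ _-_ (sum-ones n) sum-a)) ⟩
    pick k j (- A) (N - A)
      ∎
    where open ≡-Reasoning

  indicator-difference : ∀ {m} (y : Vec (Fin n) (suc m)) →
    ind (hasNoCoordIn? χ i y) - (- 1ℚ) ^ℚ suc m * ind (allCoordsIn? χ i y)
    ≡ ∑[ k < suc m ] prod (λ j → weight k j a (lookup y (punchIn k j)))
  indicator-difference {m} y =
    trans (cong₂ _-_ none-as-prod all-as-prod) (complement-difference m a (lookup y))
    where
    none-as-prod : ind (hasNoCoordIn? χ i y) ≡ prod (λ j → 1ℚ - a (lookup y j))
    none-as-prod = trans (ind-all (λ j → ¬? (χ (lookup y j) Fin.≟ i)) (hasNoCoordIn? χ i y))
                         (prod-cong-≗ (λ j → ind-¬ (χ (lookup y j) Fin.≟ i)))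
    all-as-prod : (- 1ℚ) ^ℚ suc m * ind (allCoordsIn? χ i y) ≡ prod (λ j → - a (lookup y j))
    all-as-prod = trans (cong ((- 1ℚ) ^ℚ suc m *_) (ind-all (λ j → χ (lookup y j) Fin.≟ i) (allCoordsIn? χ i y)))
                        (sym (prod-neg (λ j → a (lookup y j))))

  array-sum : ∀ {m} (S : List (Vec (Fin n) (suc m))) → IsOrthogonalArray n (suc m) m S →
    ∑ℓ S (λ y → ind (hasNoCoordIn? χ i y) - (- 1ℚ) ^ℚ suc m * ind (allCoordsIn? χ i y))
    ≡ mixedSum m (- A) (N - A)
  array-sum {m} S oa = begin
    ∑ℓ S (λ y → ind (hasNoCoordIn? χ i y) - (- 1ℚ) ^ℚ suc m * ind (allCoordsIn? χ i y))
      ≡⟨ sum-cong-≗ (λ s → indicator-difference (List.lookup S s)) ⟩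
    ∑ℓ S (λ y → ∑[ k < suc m ] term k y)
      ≡⟨ ∑-comm (λ s k → term k (List.lookup S s)) ⟩
    ∑[ k < suc m ] ∑ℓ S (term k)
      ≡⟨ sum-cong-≗ (λ k → orthogonal-array-sum S (punchIn k) (oa (punchIn k) (punchIn-mono-< k))
                                                (λ j → weight k j a)) ⟩
    ∑[ k < suc m ] prod (λ j → ∑[ x < n ] weight k j a x)
      ≡⟨ sum-cong-≗ (λ k → prod-cong-≗ (weight-sum {m} k)) ⟩
    mixedSum m (- A) (N - A)
      ∎
    where
    open ≡-Reasoning
    term : Fin (suc m) → Vec (Fin n) (suc m) → ℚ
    term k y = prod (λ j → weight k j a (lookup y (punchIn k j)))

  -- The right-hand side is the same telescoping sum, for the constant
  -- vector (c, …, c) and rescaled by n^m.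
  density-side : ∀ m → ((1ℚ - c) ^ℚ suc m - (- 1ℚ) ^ℚ suc m * c ^ℚ suc m) * N ^ℚ m ≡ mixedSum m (- A) (N - A)
  density-side m = begin
    ((1ℚ - c) ^ℚ suc m - (- 1ℚ) ^ℚ suc m * c ^ℚ suc m) * N ^ℚ m
      ≡⟨ cong (_* N ^ℚ m) (cong₂ _-_ (sym (prod-const (suc m) (1ℚ - c))) signed-power) ⟩
    (prod {suc m} (λ _ → 1ℚ - c) - prod {suc m} (λ _ → - c)) * N ^ℚ m
      ≡⟨ cong (_* N ^ℚ m) (complement-difference m (λ x → x) (λ _ → c)) ⟩
    mixedSum m (- c) (1ℚ - c) * N ^ℚ m
      ≡⟨ mixedSum-homogeneous m (- c) (1ℚ - c) N ⟩
    mixedSum m (- c * N) ((1ℚ - c) * N)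
      ≡⟨ cong₂ (mixedSum m) (trans (sym (neg-distribˡ-* c N)) (cong -_ cN≡A))
                            (trans (solve 2 (λ c N → (con 1ℚ :- c) :* N := N :- c :* N) refl c N)
                                   (cong (λ x → N - x) cN≡A)) ⟩
    mixedSum m (- A) (N - A)
      ∎
    where
    open ≡-Reasoning
    cN≡A : c * N ≡ A
    cN≡A = fraction-times-denominator (classSize χ i) n
    signed-power : (- 1ℚ) ^ℚ suc m * c ^ℚ suc m ≡ prod {suc m} (λ _ → - c)
    signed-power = sym (trans (prod-neg {suc m} (λ _ → c)) (cong ((- 1ℚ) ^ℚ suc m *_) (prod-const (suc m) c)))

  colour-identity : ∀ {m} (S : List (Vec (Fin n) (suc m))) → IsOrthogonalArray n (suc m) m S →
    ℕtoℚ (count (hasNoCoordIn? χ i) S) + (- 1ℚ) ^ℚ m * ℕtoℚ (count (allCoordsIn? χ i) S)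
    ≡ ((1ℚ - c) ^ℚ suc m - (- 1ℚ) ^ℚ suc m * c ^ℚ suc m) * N ^ℚ m
  colour-identity {m} S oa = begin
    Sᵢ + t * Mᵢ
      ≡⟨ solve 3 (λ x t y → x :+ t :* y := x :- ((:- con 1ℚ) :* t) :* y) refl Sᵢ t Mᵢ ⟩
    Sᵢ - (- 1ℚ) ^ℚ suc m * Mᵢ
      ≡⟨ cong₂ (λ σ μ → σ - (- 1ℚ) ^ℚ suc m * μ)
               (count-as-sum (hasNoCoordIn? χ i) S) (count-as-sum (allCoordsIn? χ i) S) ⟩
    ∑ℓ S none - (- 1ℚ) ^ℚ suc m * ∑ℓ S every
      ≡⟨ sym (sum-sub-* ((- 1ℚ) ^ℚ suc m) (none ∘ List.lookup S) (every ∘ List.lookup S)) ⟩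
    ∑ℓ S (λ y → none y - (- 1ℚ) ^ℚ suc m * every y)
      ≡⟨ array-sum S oa ⟩
    mixedSum m (- A) (N - A)
      ≡⟨ sym (density-side m) ⟩
    ((1ℚ - c) ^ℚ suc m - (- 1ℚ) ^ℚ suc m * c ^ℚ suc m) * N ^ℚ m
      ∎
    where
    open ≡-Reasoning
    Sᵢ Mᵢ t : ℚ
    Sᵢ = ℕtoℚ (count (hasNoCoordIn? χ i) S)
    Mᵢ = ℕtoℚ (count (allCoordsIn? χ i) S)
    t  = (- 1ℚ) ^ℚ m
    none every : Vec (Fin n) (suc m) → ℚ
    none  y = ind (hasNoCoordIn? χ i y)
    every y = ind (allCoordsIn? χ i y)

-- A vector of positive length is monochromatic for exactly one colour, so
-- the monochromatic vectors of S are counted by M = ∑_i M_i.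
monochromatic-count : ∀ {n r m} (S : List (Vec (Fin n) (suc m))) (χ : Fin n → Fin r) →
  ℕtoℚ (count (monochromatic? χ) S) ≡ ∑[ i < r ] ℕtoℚ (count (allCoordsIn? χ i) S)
monochromatic-count {r = r} S χ = begin
  ℕtoℚ (count (monochromatic? χ) S)
    ≡⟨ count-as-sum (monochromatic? χ) S ⟩
  ∑ℓ S (λ y → ind (monochromatic? χ y))
    ≡⟨ sum-cong-≗ (λ s → one-colour (List.lookup S s)) ⟩
  ∑ℓ S (λ y → ∑[ i < r ] ind (allCoordsIn? χ i y))
    ≡⟨ ∑-comm (λ s i → ind (allCoordsIn? χ i (List.lookup S s))) ⟩
  ∑[ i < r ] ∑ℓ S (λ y → ind (allCoordsIn? χ i y))
    ≡⟨ sum-cong-≗ (λ i → sym (count-as-sum (allCoordsIn? χ i) S)) ⟩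
  ∑[ i < r ] ℕtoℚ (count (allCoordsIn? χ i) S)
    ∎
  where
  open ≡-Reasoning
  one-colour : ∀ y → ind (monochromatic? χ y) ≡ ∑[ i < r ] ind (allCoordsIn? χ i y)
  one-colour y = ind-any (λ i → allCoordsIn? χ i y) (λ p p′ → trans (sym (p zero)) (p′ zero))
                         (monochromatic? χ y)

open import Data.Integer using (+_)

theorem5p1 : (d n r : ℕ) → .{{_ : NonZero n}} → d ≥ 3 →
    (S : List (Vec (Fin n) d)) → Unique S → IsOrthogonalArray n d (d ∸ 1) S →
    (χ : Fin n → Fin r) →
    let c : Fin r → ℚ
        c i = + classSize χ i / n
        Si : Fin r → ℚ
        Si i = ℕtoℚ (count (hasNoCoordIn? χ i) S)
        Mi : Fin r → ℚ
        Mi i = ℕtoℚ (count (allCoordsIn? χ i) S)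
        M : ℚ
        M = ℕtoℚ (count (monochromatic? χ) S)
        rhs : Fin r → ℚ
        rhs i = ((1ℚ - c i) ^ℚ d - (- 1ℚ) ^ℚ d * c i ^ℚ d) * ℕtoℚ n ^ℚ (d ∸ 1)
    in ((i : Fin r) → Si i + (- 1ℚ) ^ℚ (d ∸ 1) * Mi i ≡ rhs i)
       × (ℚsum Si + (- 1ℚ) ^ℚ (d ∸ 1) * M ≡ ℚsum rhs)
-- Only d ≥ 1 is needed: the first part is the identity for one colour class,
-- the second follows by summing it over the colours, using M = ∑_i M_i.
theorem5p1 zero    n r ()
theorem5p1 (suc m) n r _ S _ oa χ = per-colour , total
  where
  open ≡-Reasoning
  t : ℚ
  t = (- 1ℚ) ^ℚ m
  Si Mi rhs : Fin r → ℚ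
  Si i  = ℕtoℚ (count (hasNoCoordIn? χ i) S)
  Mi i  = ℕtoℚ (count (allCoordsIn? χ i) S)
  rhs i = ((1ℚ - c) ^ℚ suc m - (- 1ℚ) ^ℚ suc m * c ^ℚ suc m) * ℕtoℚ n ^ℚ m
    where
    c : ℚ
    c = + classSize χ i / n

  per-colour : ∀ i → Si i + t * Mi i ≡ rhs i
  per-colour i = ColourClass.colour-identity χ i S oa

  total : ℚsum Si + t * ℕtoℚ (count (monochromatic? χ) S) ≡ ℚsum rhs
  total = begin
    ℚsum Si + t * ℕtoℚ (count (monochromatic? χ) S)
      ≡⟨ cong₂ (λ σ μ → σ + t * μ) (ℚsum≡sum Si) (monochromatic-count S χ) ⟩
    sum Si + t * sum Mi             ≡⟨ cong (λ x → sum Si + x) (*-distribˡ-sum t Mi) ⟩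
    sum Si + ∑[ i < r ] (t * Mi i)  ≡⟨ sym (∑-distrib-+ Si (λ i → t * Mi i)) ⟩
    ∑[ i < r ] (Si i + t * Mi i)    ≡⟨ sum-cong-≗ per-colour ⟩
    sum rhs                         ≡⟨ sym (ℚsum≡sum rhs) ⟩
    ℚsum rhs                        ∎
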